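{- Let $k,d$ be positive integers and let $T$ be a $(k,d,z)$-tree, where $z=(0,\ldots,0)$ is the all-zero $(k,d)$-vector. Then $T$ is also a $(k+1,2d)$-tree, and in any $(k+1)$-CNF formula $F$ corresponding to $T$ every literal appears in at most $d$ clauses. Furthermore every clause of $F$ intersects at most $d(k+1)$ other clauses of $F$.
   Context: A $(k,d)$-vector is a $(k+1)$-tuple $x=(x_0,\ldots,x_k)$ of non-negative integers with $\sum_j x_j\le d$. For such $x$, a $(k,d,x)$-tree is a finite rooted binary tree in which every non-leaf vertex has exactly two children and which satisfies: (i$'$) for each $j=0,\ldots,k$ there are at most $x_j$ leaves at distance exactly $j$ from the root, and (ii) for every vertex $v$ there are at most $d$ leaves among the descendants of $v$ at distance at most $k$ from $v$. A $(K,D)$-tree is a finite rooted binary tree in which every non-leaf vertex has exactly two children such that (i) no leaf is at distance less than $K$ from the root and (ii) every vertex $v$ has at most $D$ leaves among its descendants at distance at most $K$ from $v$. A $(k+1)$-CNF formula corresponding to a rooted binary tree $T$ (every non-leaf vertex having two children, and every leaf at distance at least $k+1$ from the root) is obtained as follows: to each non-leaf vertex associate a distinct Boolean variable, and assign to its two children the two literals of that variable (one child the variable, the other its negation); the root gets no literal. For each leaf, form the clause that is the disjunction of the literals assigned to the $k+1$ vertices of the root-to-leaf path farthest from the root; $F$ is the conjunction of these clauses over all leaves. A $(k+1)$-CNF formula is a conjunction of clauses each being a disjunction of exactly $k+1$ distinct literals; two clauses intersect if they share a variable. -}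

module Defs where

open import Data.Nat using (ℕ; zero; suc; _+_; _*_; _≤_; _<_)
open import Data.Bool using (Bool; true; false; not)
open import Data.Fin using (Fin; toℕ; _≟_)
open import Data.Vec using (Vec; lookup)
open import Data.List using (List; []; _∷_; [_]; _++_; map; take; length; filter; allFin)
import Data.List as L
open import Data.List.Membership.Propositional using (_∈_)
open import Data.List.Relation.Unary.Any using (Any; any?)
open import Data.List.Relation.Unary.Unique.Propositional using (Unique)
open import Data.Product using (Σ; _×_; _,_; ∃; ∃-syntax; proj₁)
open import Data.Product.Properties using (≡-dec)
open import Relation.Binary.PropositionalEquality using (_≡_)
open import Relation.Nullary using (¬_; Dec)
open import Relation.Nullary.Decidable using (¬?; _×-dec_)
import Data.Nat as ℕ
import Data.Bool as 𝔹

data Tree : Set where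
  leaf : Tree
  node : Tree → Tree → Tree

leavesAt : ℕ → Tree → ℕ
leavesAt zero    leaf       = 1
leavesAt zero    (node _ _) = 0
leavesAt (suc j) leaf       = 0
leavesAt (suc j) (node l r) = leavesAt j l + leavesAt j r

leavesWithin : ℕ → Tree → ℕ
leavesWithin _       leaf       = 1
leavesWithin zero    (node _ _) = 0
leavesWithin (suc k) (node l r) = leavesWithin k l + leavesWithin k r

data Every (P : Tree → Set) : Tree → Set where
  leaf : P leaf → Every P leaf
  node : ∀ {l r} → P (node l r) → Every P l → Every P r → Every P (node l r)

KDVector : (k d : ℕ) → Vec ℕ (suc k) → Set
KDVector k d x = Data.Vec.sum x ≤ d
  where import Data.Vec

record KDXTree (k d : ℕ) (x : Vec ℕ (suc k)) (T : Tree) : Set where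
  field
    levels : (j : Fin (suc k)) → leavesAt (toℕ j) T ≤ lookup x j
    local  : Every (λ v → leavesWithin k v ≤ d) T

record KDTree (K D : ℕ) (T : Tree) : Set where
  field
    deep  : (j : ℕ) → j < K → leavesAt j T ≡ 0
    local : Every (λ v → leavesWithin K v ≤ D) T

zeroVec : (k : ℕ) → Vec ℕ (suc k)
zeroVec k = Data.Vec.replicate (suc k) 0
  where import Data.Vec

-- variables are natural numbers; a literal is (variable , polarity)
Literal : Set
Literal = ℕ × Bool

_≟L_ : (a b : Literal) → Dec (a ≡ b)
_≟L_ = ≡-dec ℕ._≟_ 𝔹._≟_

-- A labelled tree: each non-leaf vertex carries a variable x and a bit b;
-- its left child gets the literal (x , b), its right child (x , not b).
data LTree : Set where
  leaf : LTree
  node : ℕ → Bool → LTree → LTree → LTree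

shape : LTree → Tree
shape leaf           = leaf
shape (node _ _ l r) = node (shape l) (shape r)

internalVars : LTree → List ℕ
internalVars leaf           = []
internalVars (node x _ l r) = x ∷ internalVars l ++ internalVars r

Labelling : Tree → Set
Labelling T = Σ LTree λ L → shape L ≡ T × Unique (internalVars L)

-- For every leaf (left-to-right), the literals along its root-to-leaf path
-- (root excluded, it has no literal), listed from the leaf towards the root.
paths : LTree → List (List Literal)
paths leaf           = [ [] ]
paths (node x b l r) =
  map (λ p → p ++ [ (x , b) ]) (paths l) ++ map (λ p → p ++ [ (x , not b) ]) (paths r)

-- The (k+1)-CNF formula: one clause per leaf, consisting of the literals of
-- the k+1 path vertices farthest from the root.
cnf : ℕ → LTree → List (List Literal)
cnf k L = map (take (suc k)) (paths L)

occurrences : Literal → List (List Literal) → ℕ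
occurrences ℓ F = length (filter (λ c → any? (ℓ ≟L_) c) F)

Intersect : List Literal → List Literal → Set
Intersect c c' = Any (λ a → Any (λ b → proj₁ a ≡ proj₁ b) c') c

intersect? : (c c' : List Literal) → Dec (Intersect c c')
intersect? c c' = any? (λ a → any? (λ b → proj₁ a ℕ.≟ proj₁ b) c') c

intersectCount : (F : List (List Literal)) → Fin (length F) → ℕ
intersectCount F i =
  length (filter (λ j → ¬? (j ≟ i) ×-dec intersect? (L.lookup F i) (L.lookup F j))
                 (allFin (length F)))

-- No leaf lies within distance k of the root, so every clause consists of the
-- literals of the k+1 lowest non-root vertices of its root-to-leaf path.  A
-- literal labels a single vertex v, hence the clauses containing it come from
-- leaves at distance at most k below v: at most d of them.  The clauses of two
-- leaves f and g can only share the variable of a common ancestor; then the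
-- lowest common ancestor a is among the k+1 lowest ancestors of f, and g lies
-- within distance k below the child of a that is not above f.  Each of these
-- k+1 children has at most d such leaves, so the clause of f meets at most
-- d(k+1) others.

module Submission where

open import Defs
open import Data.Nat using (ℕ; zero; suc; _+_; _*_; _≤_; _<_; _⊓_; z≤n; s≤s)
open import Data.Nat.Properties
open import Data.Bool using (not)
open import Data.Bool.Properties using (not-¬)
open import Data.Fin using (Fin; toℕ; fromℕ<)
import Data.Fin.Properties as Fin
import Data.Vec as Vec
open import Data.Vec.Properties using (lookup-replicate)
open import Data.List using (List; []; _∷_; [_]; _++_; map; take; length; filter; allFin; tabulate; lookup)
open import Data.List.Properties
  using ( length-filter; map-cong; filter-accept; filter-reject; filter-none; filter-++
        ; length-++; ++-assoc; ++-identityʳ; map-tabulate; tabulate-lookup )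
open import Data.List.Membership.Propositional using (_∈_; _∉_; find)
open import Data.List.Membership.Propositional.Properties using (∈-map⁻; ∈-map⁺; ∈-++⁻; ∈-++⁺ˡ; ∈-++⁺ʳ; ∈-lookup; ∈-allFin)
open import Data.List.Membership.DecPropositional Data.Nat._≟_ using (_∈?_)
open import Data.List.Relation.Unary.Any using (here; there; any?)
import Data.List.Relation.Unary.All as All
open import Data.List.Relation.Unary.All.Properties using (++⁻ˡ)
open import Data.List.Relation.Unary.AllPairs using ([]; _∷_)
open import Data.List.Relation.Unary.Unique.Propositional using (Unique)
open import Data.List.Relation.Binary.Disjoint.Propositional using (Disjoint)
import Data.List.Relation.Binary.Disjoint.Propositional.Properties as Disjoint
open import Data.List.Relation.Binary.Sublist.Propositional.Properties using (Any-resp-⊆; take-⊆)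
open import Data.Product using (_×_; _,_; proj₁; proj₂; ∃; ∃₂; uncurry)
open import Data.Sum using (_⊎_; inj₁; inj₂)
import Data.Sum as Sum
open import Data.Empty using (⊥-elim)
open import Relation.Nullary using (¬_; Dec; yes; no)
open import Relation.Nullary.Decidable using (¬?; _×-dec_)
open import Relation.Unary using (Pred; Decidable)
open import Relation.Binary.Definitions using (DecidableEquality)
open import Relation.Binary.PropositionalEquality hiding ([_])
open import Function using (_∘_)
open import Level using (0ℓ)

count : {A : Set} {P : Pred A 0ℓ} → Decidable P → List A → ℕ
count P? xs = length (filter P? xs)

module _ {A : Set} where

  count-++ : {P : Pred A 0ℓ} (P? : Decidable P) (xs ys : List A) →
             count P? (xs ++ ys) ≡ count P? xs + count P? ys
  count-++ P? xs ys = trans (cong length (filter-++ P? xs ys)) (length-++ (filter P? xs))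

  count-map : {B : Set} {P : Pred B 0ℓ} (P? : Decidable P) (f : A → B) (xs : List A) →
              count P? (map f xs) ≡ count (P? ∘ f) xs
  count-map P? f []       = refl
  count-map P? f (x ∷ xs) with P? (f x)
  ... | yes _ = cong suc (count-map P? f xs)
  ... | no _  = count-map P? f xs

  count-cong : {B : Set} {P : Pred B 0ℓ} (P? : Decidable P) {f g : A → B} →
               (∀ x → f x ≡ g x) → (xs : List A) → count (P? ∘ f) xs ≡ count (P? ∘ g) xs
  count-cong P? {f} {g} f≗g xs = begin
    count (P? ∘ f) xs  ≡⟨ count-map P? f xs ⟨
    count P? (map f xs) ≡⟨ cong (count P?) (map-cong f≗g xs) ⟩
    count P? (map g xs) ≡⟨ count-map P? g xs ⟩
    count (P? ∘ g) xs  ∎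
    where open ≡-Reasoning

  count-mono : {P Q : Pred A 0ℓ} (P? : Decidable P) (Q? : Decidable Q) (xs : List A) →
               (∀ {x} → x ∈ xs → P x → Q x) → count P? xs ≤ count Q? xs
  count-mono P? Q? []       P⇒Q = z≤n
  count-mono P? Q? (x ∷ xs) P⇒Q with P? x | Q? x
  ... | yes px | yes _  = s≤s (count-mono P? Q? xs (P⇒Q ∘ there))
  ... | yes px | no ¬qx = ⊥-elim (¬qx (P⇒Q (here refl) px))
  ... | no _   | yes _  = m≤n⇒m≤1+n (count-mono P? Q? xs (P⇒Q ∘ there))
  ... | no _   | no _   = count-mono P? Q? xs (P⇒Q ∘ there)

  count-∷-≤ : {P : Pred A 0ℓ} (P? : Decidable P) {x : A} (xs : List A) →
              count P? (x ∷ xs) ≤ suc (count P? xs)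
  count-∷-≤ P? {x} xs with P? x
  ... | yes _ = ≤-refl
  ... | no _  = n≤1+n _

  count-none : {P : Pred A 0ℓ} (P? : Decidable P) {xs : List A} →
               (∀ {x} → x ∈ xs → ¬ P x) → count P? xs ≡ 0
  count-none P? ¬P = cong length (filter-none P? (All.tabulate ¬P))

  module _ (_≟_ : DecidableEquality A) {P : Pred A 0ℓ} (P? : Decidable P) where

    others? : (x : A) → Decidable (λ y → y ≢ x × P y)
    others? x y = ¬? (y ≟ x) ×-dec P? y

    count-others : ∀ {x xs} → x ∈ xs → P x → suc (count (others? x) xs) ≤ count P? xs
    count-others {x} {.x ∷ xs} (here refl) px = begin
      suc (count (others? x) (x ∷ xs)) ≡⟨ cong (suc ∘ length) (filter-reject (others? x) (λ (x≢x , _) → x≢x refl)) ⟩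
      suc (count (others? x) xs)       ≤⟨ s≤s (count-mono (others? x) P? xs (λ _ → proj₂)) ⟩
      suc (count P? xs)                ≡⟨ cong length (filter-accept P? px) ⟨
      count P? (x ∷ xs)                ∎
      where open ≤-Reasoning
    count-others {x} {y ∷ xs} (there x∈xs) px = step (P? y)
      where
      open ≤-Reasoning
      step : Dec (P y) → suc (count (others? x) (y ∷ xs)) ≤ count P? (y ∷ xs)
      step (yes py) = begin
        suc (count (others? x) (y ∷ xs)) ≤⟨ s≤s (count-∷-≤ (others? x) xs) ⟩
        suc (suc (count (others? x) xs)) ≤⟨ s≤s (count-others x∈xs px) ⟩
        suc (count P? xs)                ≡⟨ cong length (filter-accept P? py) ⟨
        count P? (y ∷ xs)                ∎
      step (no ¬py) = begin
        suc (count (others? x) (y ∷ xs)) ≡⟨ cong (suc ∘ length) (filter-reject (others? x) (¬py ∘ proj₂)) ⟩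
        suc (count (others? x) xs)       ≤⟨ count-others x∈xs px ⟩
        count P? xs                      ≡⟨ cong length (filter-reject P? ¬py) ⟨
        count P? (y ∷ xs)                ∎

length-snoc : ∀ {A : Set} (xs : List A) x → length (xs ++ [ x ]) ≡ suc (length xs)
length-snoc xs x = trans (length-++ xs) (+-comm _ 1)

length<? : ∀ {A : Set} n → Decidable (λ (xs : List A) → length xs < n)
length<? n xs = length xs <? n

∈-take⁻ : ∀ {A : Set} n {xs : List A} {u} → u ∈ take n xs → u ∈ xs
∈-take⁻ n {xs} = Any-resp-⊆ (take-⊆ n xs)

∈-take-++⁻ : ∀ {A : Set} n (xs : List A) {ys u} → u ∈ take n (xs ++ ys) →
             u ∈ take n xs ⊎ (length xs < n × u ∈ ys)
∈-take-++⁻ (suc n) []       u∈         = inj₂ (s≤s z≤n , ∈-take⁻ (suc n) u∈)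
∈-take-++⁻ (suc n) (x ∷ xs) (here u≡x) = inj₁ (here u≡x)
∈-take-++⁻ (suc n) (x ∷ xs) (there u∈) with ∈-take-++⁻ n xs u∈
... | inj₁ u∈xs        = inj₁ (there u∈xs)
... | inj₂ (short , u∈ys) = inj₂ (s≤s short , u∈ys)

Unique-++⁻ : ∀ {A : Set} (xs : List A) {ys} → Unique (xs ++ ys) →
             Unique xs × Unique ys × Disjoint xs ys
Unique-++⁻ []       u         = [] , u , λ ()
Unique-++⁻ (x ∷ xs) {ys} (x∉ ∷ u) with Unique-++⁻ xs u
... | uxs , uys , xs#ys = ++⁻ˡ xs x∉ ∷ uxs , uys , x∷xs#ys
  where
  x∷xs#ys : Disjoint (x ∷ xs) ys
  x∷xs#ys (here refl , v∈ys) = All.lookup x∉ (∈-++⁺ʳ xs v∈ys) refl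
  x∷xs#ys (there v∈xs , v∈ys) = xs#ys (v∈xs , v∈ys)

Local : ℕ → ℕ → Tree → Set
Local k d = Every (λ v → leavesWithin k v ≤ d)

Every-root : ∀ {P : Tree → Set} {T} → Every P T → P T
Every-root (leaf p)     = p
Every-root (node p _ _) = p

local-suc : ∀ {k d T} → 1 ≤ d → Local k d T → Local (suc k) (2 * d) T
local-suc {d = d} 1≤d (leaf _)       = leaf (≤-trans 1≤d (m≤m+n d _))
local-suc {d = d} 1≤d (node _ Ll Lr) =
  node (+-mono-≤ (Every-root Ll) (≤-trans (Every-root Lr) (≤-reflexive (sym (+-identityʳ d)))))
       (local-suc 1≤d Ll) (local-suc 1≤d Lr)

zeroVec-empty-levels : ∀ {k d T} → KDXTree k d (zeroVec k) T → ∀ j → j < suc k → leavesAt j T ≡ 0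
zeroVec-empty-levels {k} {T = T} T-ok j j<1+k = n≤0⇒n≡0 (begin
  leavesAt j T                          ≡⟨ cong (λ i → leavesAt i T) (Fin.toℕ-fromℕ< j<1+k) ⟨
  leavesAt (toℕ (fromℕ< j<1+k)) T       ≤⟨ KDXTree.levels T-ok (fromℕ< j<1+k) ⟩
  Vec.lookup (zeroVec k) (fromℕ< j<1+k) ≡⟨ lookup-replicate (fromℕ< j<1+k) 0 ⟩
  0                                     ∎)
  where open ≤-Reasoning

vars : List Literal → List ℕ
vars = map proj₁

∈-paths-node⁻ : ∀ x b l r {q} → q ∈ paths (node x b l r) →
                (∃ λ p → p ∈ paths l × q ≡ p ++ [ x , b ])
              ⊎ (∃ λ p → p ∈ paths r × q ≡ p ++ [ x , not b ])
∈-paths-node⁻ x b l r q∈ with ∈-++⁻ (map (_++ [ x , b ]) (paths l)) q∈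
... | inj₁ q∈l = inj₁ (∈-map⁻ (_++ [ x , b ]) q∈l)
... | inj₂ q∈r = inj₂ (∈-map⁻ (_++ [ x , not b ]) q∈r)

count-paths-node : ∀ {P : Pred (List Literal) 0ℓ} (P? : Decidable P) x b l r →
  count P? (paths (node x b l r))
    ≡ count (P? ∘ (_++ [ x , b ])) (paths l) + count (P? ∘ (_++ [ x , not b ])) (paths r)
count-paths-node P? x b l r =
  trans (count-++ P? (map (_++ [ x , b ]) (paths l)) _)
        (cong₂ _+_ (count-map P? _ (paths l)) (count-map P? _ (paths r)))

∈-paths-node⇒∷ : ∀ x b l r {q} → q ∈ paths (node x b l r) → ∃₂ λ w q' → q ≡ w ∷ q'
∈-paths-node⇒∷ x b l r q∈ with ∈-paths-node⁻ x b l r q∈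
... | inj₁ ([]    , _ , refl) = _ , _ , refl
... | inj₁ (_ ∷ _ , _ , refl) = _ , _ , refl
... | inj₂ ([]    , _ , refl) = _ , _ , refl
... | inj₂ (_ ∷ _ , _ , refl) = _ , _ , refl

var∈internalVars : ∀ L {p u} → p ∈ paths L → u ∈ p → proj₁ u ∈ internalVars L
var∈internalVars leaf (here refl) ()
var∈internalVars (node x b l r) p∈ u∈ with ∈-paths-node⁻ x b l r p∈
... | inj₁ (p , p∈l , refl) with ∈-++⁻ p u∈
...   | inj₁ u∈p       = there (∈-++⁺ˡ (var∈internalVars l p∈l u∈p))
...   | inj₂ (here refl) = here refl
var∈internalVars (node x b l r) p∈ u∈ | inj₂ (p , p∈r , refl) with ∈-++⁻ p u∈
...   | inj₁ u∈p       = there (∈-++⁺ʳ (internalVars l) (var∈internalVars r p∈r u∈p))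
...   | inj₂ (here refl) = here refl

count-short-paths : ∀ j L → count (length<? (suc j)) (paths L) ≤ leavesWithin j (shape L)
count-short-paths j       leaf           = ≤-refl
count-short-paths zero    (node x b l r) =
  ≤-reflexive (count-none (length<? 1) (nonempty ∘ ∈-paths-node⇒∷ x b l r))
  where
  nonempty : ∀ {p : List Literal} → (∃₂ λ w p' → p ≡ w ∷ p') → ¬ length p < 1
  nonempty (_ , _ , refl) (s≤s ())
count-short-paths (suc j) (node x b l r) = begin
  count (length<? (suc (suc j))) (paths (node x b l r))
    ≡⟨ count-paths-node (length<? (suc (suc j))) x b l r ⟩
  count (length<? (suc (suc j)) ∘ (_++ [ x , b ])) (paths l)
    + count (length<? (suc (suc j)) ∘ (_++ [ x , not b ])) (paths r)
    ≤⟨ +-mono-≤ (count-mono _ (length<? (suc j)) (paths l) (λ {p} _ → unsnoc p))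
                (count-mono _ (length<? (suc j)) (paths r) (λ {p} _ → unsnoc p)) ⟩
  count (length<? (suc j)) (paths l) + count (length<? (suc j)) (paths r)
    ≤⟨ +-mono-≤ (count-short-paths j l) (count-short-paths j r) ⟩
  leavesWithin j (shape l) + leavesWithin j (shape r) ∎
  where
  open ≤-Reasoning
  unsnoc : ∀ {a : Literal} p → length (p ++ [ a ]) < suc (suc j) → length p < suc j
  unsnoc {a} p lt = ≤-pred (subst (_< suc (suc j)) (length-snoc p a) lt)

record DistinctLabels (x : ℕ) (l r : LTree) : Set where
  field
    x∉l      : x ∉ internalVars l
    x∉r      : x ∉ internalVars r
    unique-l : Unique (internalVars l)
    unique-r : Unique (internalVars r)
    l#r      : Disjoint (internalVars l) (internalVars r)

distinctLabels : ∀ {x l r} → Unique (x ∷ internalVars l ++ internalVars r) → DistinctLabels x l r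
distinctLabels {l = l} (x∉ ∷ u) with Unique-++⁻ (internalVars l) u
... | ul , ur , l#r = record
  { x∉l      = λ x∈l → All.lookup x∉ (∈-++⁺ˡ x∈l) refl
  ; x∉r      = λ x∈r → All.lookup x∉ (∈-++⁺ʳ (internalVars l) x∈r) refl
  ; unique-l = ul
  ; unique-r = ur
  ; l#r      = l#r
  }

+-≤-one-zero : ∀ {m n d} → m ≤ d → n ≤ d → m ≡ 0 ⊎ n ≡ 0 → m + n ≤ d
+-≤-one-zero _   n≤d (inj₁ refl) = n≤d
+-≤-one-zero m≤d _   (inj₂ refl) = ≤-trans (≤-reflexive (+-identityʳ _)) m≤d

+-≤-capped-step : ∀ {X Y} m n d → X ≤ 1 + d * (m ⊓ n) →
  (n < m → Y ≤ d) → (¬ n < m → Y ≡ 0) → X + Y ≤ 1 + d * (m ⊓ suc n)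
+-≤-capped-step {X} {Y} m n d X≤ Y≤ Y≡0 with n <? m
... | yes n<m = begin
  X + Y                  ≤⟨ +-mono-≤ X≤ (Y≤ n<m) ⟩
  1 + d * (m ⊓ n) + d    ≡⟨ cong (λ i → 1 + d * i + d) (m≥n⇒m⊓n≡n (<⇒≤ n<m)) ⟩
  1 + d * n + d          ≡⟨ cong suc (trans (+-comm (d * n) d) (sym (*-suc d n))) ⟩
  1 + d * suc n          ≡⟨ cong (λ i → 1 + d * i) (m≥n⇒m⊓n≡n n<m) ⟨
  1 + d * (m ⊓ suc n)    ∎
  where open ≤-Reasoning
... | no n≮m = begin
  X + Y                  ≡⟨ cong (X +_) (Y≡0 n≮m) ⟩
  X + 0                  ≡⟨ +-identityʳ X ⟩
  X                      ≤⟨ X≤ ⟩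
  1 + d * (m ⊓ n)        ≤⟨ s≤s (*-monoʳ-≤ d (⊓-monoʳ-≤ m (n≤1+n n))) ⟩
  1 + d * (m ⊓ suc n)    ∎
  where open ≤-Reasoning

extend-disjoint : ∀ {x l r} V → DistinctLabels x l r → Disjoint V (x ∷ internalVars l ++ internalVars r) →
  Disjoint (x ∷ V) (internalVars l) × Disjoint (x ∷ V) (internalVars r)
extend-disjoint {x} {l} {r} V fresh V#L = V#l , V#r
  where
  open DistinctLabels fresh
  V#l : Disjoint (x ∷ V) (internalVars l)
  V#l (here refl , v∈l) = x∉l v∈l
  V#l (there v∈V , v∈l) = V#L (v∈V , there (∈-++⁺ˡ v∈l))
  V#r : Disjoint (x ∷ V) (internalVars r)
  V#r (here refl , v∈r) = x∉r v∈r
  V#r (there v∈V , v∈r) = V#L (v∈V , there (∈-++⁺ʳ (internalVars l) v∈r))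

count-allFin-lookup : ∀ {A : Set} {P : Pred A 0ℓ} (P? : Decidable P) (xs : List A) →
  count (P? ∘ lookup xs) (allFin (length xs)) ≡ count P? xs
count-allFin-lookup P? xs = begin
  count (P? ∘ lookup xs) (allFin (length xs)) ≡⟨ count-map P? (lookup xs) (allFin (length xs)) ⟨
  count P? (map (lookup xs) (allFin (length xs))) ≡⟨ cong (count P?) (map-tabulate (λ i → i) (lookup xs)) ⟩
  count P? (tabulate (lookup xs))              ≡⟨ cong (count P?) (tabulate-lookup xs) ⟩
  count P? xs                                  ∎
  where open ≡-Reasoning

suc-intersectCount≤ : ∀ F i → Intersect (lookup F i) (lookup F i) →
  suc (intersectCount F i) ≤ count (intersect? (lookup F i)) F
suc-intersectCount≤ F i self = begin
  suc (intersectCount F i)                            ≤⟨ count-others Fin._≟_ (intersect? c ∘ lookup F) (∈-allFin i) self ⟩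
  count (intersect? c ∘ lookup F) (allFin (length F)) ≡⟨ count-allFin-lookup (intersect? c) F ⟩
  count (intersect? c) F                              ∎
  where
  open ≤-Reasoning
  c : List Literal
  c = lookup F i

module Clauses (k d : ℕ) where

  clause : List Literal → List Literal
  clause = take (suc k)

  ∈-clause-++⁻ : ∀ L {p t u} → p ∈ paths L → u ∈ clause (p ++ t) →
                 proj₁ u ∈ internalVars L ⊎ (length p < suc k × proj₁ u ∈ vars t)
  ∈-clause-++⁻ L {p} p∈ u∈ with ∈-take-++⁻ (suc k) p u∈
  ... | inj₁ u∈p           = inj₁ (var∈internalVars L p∈ (∈-take⁻ (suc k) u∈p))
  ... | inj₂ (short , u∈t) = inj₂ (short , ∈-map⁺ proj₁ u∈t)

  module Occurrences (ℓ : Literal) where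

    contains? : Decidable (λ p → ℓ ∈ clause p)
    contains? p = any? (ℓ ≟L_) (clause p)

    count-contains-absent : ∀ L → proj₁ ℓ ∉ internalVars L → count contains? (paths L) ≡ 0
    count-contains-absent L ℓ∉L =
      count-none contains? (λ p∈ ℓ∈ → ℓ∉L (var∈internalVars L p∈ (∈-take⁻ (suc k) ℓ∈)))

    count-contains-other : ∀ A {a} → ℓ ≢ a →
      count (contains? ∘ (_++ [ a ])) (paths A) ≤ count contains? (paths A)
    count-contains-other A ℓ≢a = count-mono _ contains? (paths A) drop-a
      where
      drop-a : ∀ {p} → p ∈ paths A → ℓ ∈ clause (p ++ [ _ ]) → ℓ ∈ clause p
      drop-a {p} _ ℓ∈ with ∈-take-++⁻ (suc k) p ℓ∈
      ... | inj₁ ℓ∈p             = ℓ∈p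
      ... | inj₂ (_ , here ℓ≡a) = ⊥-elim (ℓ≢a ℓ≡a)

    count-contains-self : ∀ A → proj₁ ℓ ∉ internalVars A →
      count (contains? ∘ (_++ [ ℓ ])) (paths A) ≤ leavesWithin k (shape A)
    count-contains-self A ℓ∉A = ≤-trans (count-mono _ (length<? (suc k)) (paths A) short)
                                        (count-short-paths k A)
      where
      short : ∀ {p} → p ∈ paths A → ℓ ∈ clause (p ++ [ ℓ ]) → length p < suc k
      short p∈ ℓ∈ with ∈-clause-++⁻ A p∈ ℓ∈
      ... | inj₁ ℓ∈A       = ⊥-elim (ℓ∉A ℓ∈A)
      ... | inj₂ (short , _) = short

    count-contains-clear : ∀ A {a} → ℓ ≢ a → proj₁ ℓ ∉ internalVars A →
      count (contains? ∘ (_++ [ a ])) (paths A) ≡ 0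
    count-contains-clear A ℓ≢a ℓ∉A =
      n≤0⇒n≡0 (≤-trans (count-contains-other A ℓ≢a) (≤-reflexive (count-contains-absent A ℓ∉A)))

    one-side-clear : ∀ {x b l r} → DistinctLabels x l r →
        (ℓ ≢ (x , b) × proj₁ ℓ ∉ internalVars l) ⊎ (ℓ ≢ (x , not b) × proj₁ ℓ ∉ internalVars r)
    one-side-clear {x} {b} {l} fresh with ℓ ≟L (x , b) | proj₁ ℓ ∈? internalVars l
    ... | yes refl | _       = inj₂ (not-¬ refl ∘ cong proj₂ , x∉r)
      where open DistinctLabels fresh
    ... | no ℓ≢    | no ℓ∉l = inj₁ (ℓ≢ , ℓ∉l)
    ... | no _     | yes ℓ∈l = inj₂ ((λ { refl → x∉l ℓ∈l }) , λ ℓ∈r → l#r (ℓ∈l , ℓ∈r))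
      where open DistinctLabels fresh

    count-contains-bound : ∀ L → Unique (internalVars L) → Local k d (shape L) →
                           count contains? (paths L) ≤ d
    count-contains-side : ∀ A {a} → proj₁ a ∉ internalVars A → Unique (internalVars A) →
      Local k d (shape A) → count (contains? ∘ (_++ [ a ])) (paths A) ≤ d

    count-contains-bound leaf _ _ = z≤n
    count-contains-bound (node x b l r) u (node _ Ll Lr) = begin
      count contains? (paths (node x b l r))      ≡⟨ count-paths-node contains? x b l r ⟩
      count (contains? ∘ (_++ [ x , b ])) (paths l)
        + count (contains? ∘ (_++ [ x , not b ])) (paths r)
        ≤⟨ +-≤-one-zero (count-contains-side l x∉l unique-l Ll)
                        (count-contains-side r x∉r unique-r Lr) one-zero ⟩
      d                                           ∎
      where
      open ≤-Reasoning
      fresh : DistinctLabels x l r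
      fresh = distinctLabels u
      open DistinctLabels fresh
      one-zero : count (contains? ∘ (_++ [ x , b ])) (paths l) ≡ 0
               ⊎ count (contains? ∘ (_++ [ x , not b ])) (paths r) ≡ 0
      one-zero = Sum.map (uncurry (count-contains-clear l)) (uncurry (count-contains-clear r))
                         (one-side-clear {b = b} fresh)

    count-contains-side A {a} a∉A u L with ℓ ≟L a
    ... | yes refl = ≤-trans (count-contains-self A a∉A) (Every-root L)
    ... | no ℓ≢a   = ≤-trans (count-contains-other A ℓ≢a) (count-contains-bound A u L)

  meets? : (c s : List Literal) → Decidable (λ p → Intersect c (clause (p ++ s)))
  meets? c s p = intersect? c (clause (p ++ s))

  count-meets-node : ∀ c s x b l r →
    count (meets? c s) (paths (node x b l r))
      ≡ count (meets? c ((x , b) ∷ s)) (paths l) + count (meets? c ((x , not b) ∷ s)) (paths r)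
  count-meets-node c s x b l r =
    trans (count-paths-node (meets? c s) x b l r)
          (cong₂ _+_ (count-cong (intersect? c) (λ p → cong clause (++-assoc p _ s)) (paths l))
                     (count-cong (intersect? c) (λ p → cong clause (++-assoc p _ s)) (paths r)))

  -- Clauses through disjoint subtrees A and B can only share a variable of the
  -- literals t, t' above them, which lie in both clauses only if both paths are short.
  meet⇒short : ∀ A B {q p t t'} → q ∈ paths A → p ∈ paths B → vars t ≡ vars t' →
    Disjoint (internalVars A) (internalVars B) →
    Disjoint (vars t) (internalVars A) → Disjoint (vars t') (internalVars B) →
    Intersect (clause (q ++ t)) (clause (p ++ t')) → length q < suc k × length p < suc k
  meet⇒short A B q∈ p∈ t≡t' A#B t#A t'#B I with find I
  ... | (v , _) , u∈ , J with find J
  ... | (.v , _) , w∈ , refl with ∈-clause-++⁻ A q∈ u∈ | ∈-clause-++⁻ B p∈ w∈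
  ... | inj₂ (q-short , _) | inj₂ (p-short , _) = q-short , p-short
  ... | inj₁ v∈A | inj₁ v∈B        = ⊥-elim (A#B (v∈A , v∈B))
  ... | inj₁ v∈A | inj₂ (_ , v∈t') = ⊥-elim (t#A (subst (v ∈_) (sym t≡t') v∈t' , v∈A))
  ... | inj₂ (_ , v∈t) | inj₁ v∈B  = ⊥-elim (t'#B (subst (v ∈_) t≡t' v∈t , v∈B))

  meets-step : ∀ A B x β β' s {q} → q ∈ paths A → Disjoint (internalVars A) (internalVars B) →
    Disjoint (x ∷ vars s) (internalVars A) → Disjoint (x ∷ vars s) (internalVars B) →
    Local k d (shape B) →
    count (meets? (clause (q ++ (x , β) ∷ s)) ((x , β) ∷ s)) (paths A) ≤ 1 + d * (suc k ⊓ length q) →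
    count (meets? (clause (q ++ (x , β) ∷ s)) ((x , β) ∷ s)) (paths A)
      + count (meets? (clause (q ++ (x , β) ∷ s)) ((x , β') ∷ s)) (paths B)
      ≤ 1 + d * (suc k ⊓ suc (length q))
  meets-step A B x β β' s {q} q∈ A#B s#A s#B LB A-bound =
    +-≤-capped-step (suc k) (length q) d A-bound other-side other-side-empty
    where
    c : List Literal
    c = clause (q ++ (x , β) ∷ s)
    short : ∀ {p} → p ∈ paths B → Intersect c (clause (p ++ (x , β') ∷ s)) → length q < suc k × length p < suc k
    short p∈ = meet⇒short A B q∈ p∈ refl A#B s#A s#B
    other-side : length q < suc k → count (meets? c ((x , β') ∷ s)) (paths B) ≤ d
    other-side _ = begin
      count (meets? c ((x , β') ∷ s)) (paths B)
        ≤⟨ count-mono _ (length<? (suc k)) (paths B) (λ p∈ → proj₂ ∘ short p∈) ⟩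
      count (length<? (suc k)) (paths B)         ≤⟨ count-short-paths k B ⟩
      leavesWithin k (shape B)                   ≤⟨ Every-root LB ⟩
      d                                          ∎
      where open ≤-Reasoning
    other-side-empty : ¬ length q < suc k → count (meets? c ((x , β') ∷ s)) (paths B) ≡ 0
    other-side-empty q-long = count-none _ (λ p∈ → q-long ∘ proj₁ ∘ short p∈)

  -- s lists the literals above the root of L.  Besides itself, the clause of q meets
  -- at most d clauses on the far side of each ancestor of its leaf inside the window.
  meets-bound : ∀ L s {q} → q ∈ paths L → Unique (internalVars L) →
    Disjoint (vars s) (internalVars L) → Local k d (shape L) →
    count (meets? (clause (q ++ s)) s) (paths L) ≤ 1 + d * (suc k ⊓ length q)
  meets-bound leaf s {q} _ _ _ _ = ≤-trans (length-filter (meets? (clause (q ++ s)) s) (paths leaf)) (s≤s z≤n)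
  meets-bound (node x b l r) s q∈ u s#L (node _ Ll Lr) = by-side (∈-paths-node⁻ x b l r q∈)
    where
    fresh : DistinctLabels x l r
    fresh = distinctLabels u
    open DistinctLabels fresh
    s#l : Disjoint (x ∷ vars s) (internalVars l)
    s#l = proj₁ (extend-disjoint (vars s) fresh s#L)
    s#r : Disjoint (x ∷ vars s) (internalVars r)
    s#r = proj₂ (extend-disjoint (vars s) fresh s#L)

    count-node : List Literal → List Literal → ℕ
    count-node c s' = count (meets? c s') (paths (node x b l r))

    reassociate : ∀ q a →
      count-node (clause (q ++ a ∷ s)) s ≤ 1 + d * (suc k ⊓ suc (length q)) →
      count-node (clause ((q ++ [ a ]) ++ s)) s ≤ 1 + d * (suc k ⊓ length (q ++ [ a ]))
    reassociate q a = subst₂ (λ q' n → count-node (clause q') s ≤ 1 + d * (suc k ⊓ n))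
                             (sym (++-assoc q [ a ] s)) (sym (length-snoc q a))

    by-side : ∀ {q} → (∃ λ p → p ∈ paths l × q ≡ p ++ [ x , b ])
                    ⊎ (∃ λ p → p ∈ paths r × q ≡ p ++ [ x , not b ]) →
              count-node (clause (q ++ s)) s ≤ 1 + d * (suc k ⊓ length q)
    by-side (inj₁ (q , q∈l , refl)) = reassociate q (x , b) (begin
      count-node c s                                                      ≡⟨ count-meets-node c s x b l r ⟩
      count (meets? c ((x , b) ∷ s)) (paths l) + count (meets? c ((x , not b) ∷ s)) (paths r)
        ≤⟨ meets-step l r x b (not b) s q∈l l#r s#l s#r Lr (meets-bound l _ q∈l unique-l s#l Ll) ⟩
      1 + d * (suc k ⊓ suc (length q))                                    ∎)
      where
      open ≤-Reasoning
      c : List Literal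
      c = clause (q ++ (x , b) ∷ s)
    by-side (inj₂ (q , q∈r , refl)) = reassociate q (x , not b) (begin
      count-node c s                                                      ≡⟨ count-meets-node c s x b l r ⟩
      count (meets? c ((x , b) ∷ s)) (paths l) + count (meets? c ((x , not b) ∷ s)) (paths r)
        ≡⟨ +-comm (count (meets? c ((x , b) ∷ s)) (paths l)) _ ⟩
      count (meets? c ((x , not b) ∷ s)) (paths r) + count (meets? c ((x , b) ∷ s)) (paths l)
        ≤⟨ meets-step r l x (not b) b s q∈r (Disjoint.sym l#r) s#r s#l Ll
                      (meets-bound r _ q∈r unique-r s#r Lr) ⟩
      1 + d * (suc k ⊓ suc (length q))                                    ∎)
      where
      open ≤-Reasoning
      c : List Literal
      c = clause (q ++ (x , not b) ∷ s)

  count-meets-clause : ∀ L {q} → q ∈ paths L → Unique (internalVars L) → Local k d (shape L) →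
    count (intersect? (clause q)) (cnf k L) ≤ 1 + d * suc k
  count-meets-clause L {q} q∈ u LL = begin
    count (intersect? (clause q)) (cnf k L)
      ≡⟨ count-map (intersect? (clause q)) clause (paths L) ⟩
    count (intersect? (clause q) ∘ clause) (paths L)
      ≡⟨ count-cong (intersect? (clause q)) (λ p → cong clause (++-identityʳ p)) (paths L) ⟨
    count (meets? (clause q) []) (paths L)
      ≡⟨ cong (λ q' → count (meets? (clause q') []) (paths L)) (++-identityʳ q) ⟨
    count (meets? (clause (q ++ [])) []) (paths L)
      ≤⟨ meets-bound L [] q∈ u (λ { (() , _) }) LL ⟩
    1 + d * (suc k ⊓ length q)
      ≤⟨ s≤s (*-monoʳ-≤ d (m⊓n≤m (suc k) _)) ⟩
    1 + d * suc k ∎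
    where open ≤-Reasoning

  clause-self-intersect : ∀ x b l r {q} → q ∈ paths (node x b l r) → Intersect (clause q) (clause q)
  clause-self-intersect x b l r q∈ with ∈-paths-node⇒∷ x b l r q∈
  ... | _ , _ , refl = here (here refl)

  intersectCount-bound : ∀ L → Unique (internalVars L) → KDXTree k d (zeroVec k) (shape L) →
    ∀ i → intersectCount (cnf k L) i ≤ d * suc k
  intersectCount-bound leaf _ T-ok _ with () ← zeroVec-empty-levels T-ok 0 (s≤s z≤n)
  intersectCount-bound L@(node x b l r) u T-ok i with ∈-map⁻ clause (∈-lookup {xs = cnf k L} i)
  ... | q , q∈ , cᵢ≡ = ≤-pred (begin
    suc (intersectCount F i)           ≤⟨ suc-intersectCount≤ F i self ⟩
    count (intersect? (lookup F i)) F  ≡⟨ cong (λ c → count (intersect? c) F) cᵢ≡ ⟩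
    count (intersect? (clause q)) F    ≤⟨ count-meets-clause L q∈ u (KDXTree.local T-ok) ⟩
    1 + d * suc k                      ∎)
    where
    open ≤-Reasoning
    F : List (List Literal)
    F = cnf k L
    self : Intersect (lookup F i) (lookup F i)
    self = subst (λ c → Intersect c c) (sym cᵢ≡) (clause-self-intersect x b l r q∈)

  occurrences-bound : ∀ L → Unique (internalVars L) → Local k d (shape L) →
    ∀ ℓ → occurrences ℓ (cnf k L) ≤ d
  occurrences-bound L u LL ℓ = begin
    occurrences ℓ (cnf k L)   ≡⟨ count-map (λ c → any? (ℓ ≟L_) c) clause (paths L) ⟩
    count contains? (paths L) ≤⟨ count-contains-bound L u LL ⟩
    d                         ∎
    where
    open ≤-Reasoning
    open Occurrences ℓ

lemma7 : (k d : ℕ) → 1 ≤ k → 1 ≤ d → (T : Tree) → KDXTree k d (zeroVec k) T →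
    KDTree (suc k) (2 * d) T
    × ((L : Labelling T) →
        ((ℓ : Literal) → occurrences ℓ (cnf k (proj₁ L)) ≤ d)
        × ((i : Fin (length (cnf k (proj₁ L)))) → intersectCount (cnf k (proj₁ L)) i ≤ d * suc k))
lemma7 k d _ 1≤d T T-ok = kdTree , labelled
  where
  open Clauses k d
  kdTree : KDTree (suc k) (2 * d) T
  kdTree = record { deep = zeroVec-empty-levels T-ok ; local = local-suc 1≤d (KDXTree.local T-ok) }
  labelled : (L : Labelling T) →
    ((ℓ : Literal) → occurrences ℓ (cnf k (proj₁ L)) ≤ d)
    × ((i : Fin (length (cnf k (proj₁ L)))) → intersectCount (cnf k (proj₁ L)) i ≤ d * suc k)
  labelled (L , shape≡T , u) =
    occurrences-bound L u (KDXTree.local L-ok) , intersectCount-bound L u L-ok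
    where
    L-ok : KDXTree k d (zeroVec k) (shape L)
    L-ok = subst (KDXTree k d (zeroVec k)) (sym shape≡T) T-ok
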